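{- Let $G$ be a connected bipartite graph with bipartition $(X,Y)$, and let $n\geq 3$ be an odd integer. If $|X|\geq\delta(G)+1$, $|Y|\geq\delta(G)+1$ and $\kappa(G)>\frac{2}{n}\delta(G)$, then $G\times C_{n}$ is super-$\kappa$.
   Context: All graphs are simple. $C_n$ is the cycle on $n$ vertices. The direct product $G\times H$ has vertex set $V(G)\times V(H)$, with $(u_1,v_1)(u_2,v_2)$ an edge iff $u_1u_2\in E(G)$ and $v_1v_2\in E(H)$. $\delta(G)$ is the minimum degree. For a non-complete graph $G$, the connectivity $\kappa(G)$ is the minimum size of a vertex set $S$ such that $G-S$ is disconnected; for a complete graph $\kappa(G)=|V(G)|-1$. A graph is super connected (super-$\kappa$) if every minimum vertex cut is the neighborhood of some vertex of minimum degree. -}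

module Defs where

open import Data.Nat using (ℕ; zero; suc; _*_; _+_; _≤_; _<_; _∸_; _⊓_; _%_; _≡ᵇ_)
open import Data.Bool using (Bool; true; false; not; _∧_; _∨_)
open import Data.Fin using (Fin; toℕ; remQuot)
open import Data.Fin.Subset using (Subset; _∈_; _∉_; ∣_∣; ⊥)
open import Data.Vec using (Vec; tabulate; foldr; map; allFin)
open import Data.Product using (Σ; ∃; _×_; _,_)
open import Relation.Binary.PropositionalEquality using (_≡_; _≢_)
open import Relation.Nullary using (¬_)
open import Data.Sum using (_⊎_)

Graph : ℕ → Set
Graph v = Fin v → Fin v → Bool

IsSimple : ∀ {v} → Graph v → Set
IsSimple {v} G = (∀ (i j : Fin v) → G i j ≡ G j i) × (∀ (i : Fin v) → G i i ≡ false)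

N : ∀ {v} → Graph v → Fin v → Subset v
N G u = tabulate (G u)

deg : ∀ {v} → Graph v → Fin v → ℕ
deg G u = ∣ N G u ∣

-- Minimum degree δ(G) (the initial value v is an upper bound for all degrees;
-- for the empty graph this gives 0).
δ : ∀ {v} → Graph v → ℕ
δ {v} G = foldr (λ _ → ℕ) _⊓_ v (map (deg G) (allFin v))

data Reach {v} (G : Graph v) (S : Subset v) : Fin v → Fin v → Set where
  here : ∀ {u} → u ∉ S → Reach G S u u
  step : ∀ {u w x} → u ∉ S → G u w ≡ true → Reach G S w x → Reach G S u x

Connected : ∀ {v} → Graph v → Set
Connected {v} G = ∀ (u w : Fin v) → Reach G ⊥ u w

IsComplete : ∀ {v} → Graph v → Set
IsComplete {v} G = ∀ (u w : Fin v) → u ≢ w → G u w ≡ true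

IsCut : ∀ {v} → Graph v → Subset v → Set
IsCut {v} G S = Σ (Fin v) λ u → Σ (Fin v) λ w → u ∉ S × w ∉ S × ¬ Reach G S u w

IsMinCut : ∀ {v} → Graph v → Subset v → Set
IsMinCut {v} G S = IsCut G S × (∀ (T : Subset v) → IsCut G T → ∣ S ∣ ≤ ∣ T ∣)

IsConnectivity : ∀ {v} → Graph v → ℕ → Set
IsConnectivity {v} G k =
  (IsComplete G × k ≡ v ∸ 1)
  ⊎ (¬ IsComplete G × Σ (Subset v) λ S → IsMinCut G S × ∣ S ∣ ≡ k)

SuperConnected : ∀ {v} → Graph v → Set
SuperConnected {v} G =
  ∀ (S : Subset v) → IsMinCut G S → Σ (Fin v) λ u → deg G u ≡ δ G × S ≡ N G u

Cycle : (n : ℕ) → Graph n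
Cycle n i j = (((suc (toℕ i)) % suc (n ∸ 1)) ≡ᵇ toℕ j) ∨ (((suc (toℕ j)) % suc (n ∸ 1)) ≡ᵇ toℕ i)

-- Direct product G × H on Fin (v * m), vertex (a , b) encoded via combine/remQuot.
_×ᵍ_ : ∀ {v m} → Graph v → Graph m → Graph (v * m)
_×ᵍ_ {v} {m} G H p q with remQuot {v} m p | remQuot {v} m q
... | a , b | a' , b' = G a a' ∧ H b b'

-- (X , Y) is a bipartition of G: side u = false means u ∈ X, true means u ∈ Y.
IsBipartition : ∀ {v} → Graph v → (Fin v → Bool) → Set
IsBipartition {v} G side = ∀ (u w : Fin v) → G u w ≡ true → side u ≢ side w

X : ∀ {v} → (Fin v → Bool) → Subset v
X side = tabulate (λ u → not (side u))

Y : ∀ {v} → (Fin v → Bool) → Subset v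
Y side = tabulate side

-- Let n = 2t+1 and H = G × C_n. As n is odd, the vertices of H fall into 2n layers L_T, indexed by
-- T mod 2n: L_T = {(x , T mod n) : x lies on the side of parity T}. Every edge of H joins consecutive
-- layers, and each block L_B ∪ L_{B+1} spans a copy of G. A minimum cut S has |S| ≤ δ(H) ≤ 2δ(G), so it
-- suffices to find a vertex z with N(z) ⊆ S. Let S separate u from w. If both meet each of the n blocks
-- L_{2k} ∪ L_{2k+1}, then S cuts every copy of G and |S| ≥ nκ(G) > 2δ(G). Otherwise the component of
-- u or w misses a block, so going round the layers it is entered at some L_{a+1} and left at some L_b.
-- Then S contains the ≥ δ(G) neighbours of a reached vertex in L_a and in L_{b+1}, leaving no vertex
-- of S in any touched layer. If L_{a+2} is untouched, a reached vertex of L_{a+1} has N(z) ⊆ S;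
-- otherwise the block L_{a+1} ∪ L_{a+2} avoids S, the component contains it entirely, and all of L_a,
-- more than δ(G) vertices, lies in S: too many.

module Submission where

open import Defs
open import Data.Bool using (Bool; true; false; not; _∧_; _∨_; _xor_) renaming (_≟_ to _≟ᵇ_)
open import Data.Bool.Properties
  using (T-≡; not-distribˡ-xor; not-distribʳ-xor; xor-same; xor-identityʳ; not-¬; ¬-not; not-involutive
        ; ∨-comm; ∨-zeroʳ; ∧-identityʳ)
open import Data.Empty using (⊥; ⊥-elim)
open import Data.Fin using (Fin; zero; suc; toℕ; combine; remQuot; fromℕ<; punchIn; _↑ˡ_; _↑ʳ_)
import Data.Fin.Properties as Finₚ
open import Data.Fin.Properties using (any?; all?; ¬∀⟶∃¬)
open import Data.Fin.Subset using (Subset; _∉_; ∣_∣)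
open import Data.Fin.Subset.Properties using (∣p∣≤n)
open import Data.Nat using (ℕ; zero; suc; _+_; _*_; _∸_; _≤_; _<_; _⊓_; _%_; _≡ᵇ_; z≤n; s≤s; s≤s⁻¹; NonZero; _<?_)
open import Data.Nat.Properties
open import Data.Nat.DivMod
open import Data.Product using (∃; ∃₂; Σ; _×_; _,_; proj₁; proj₂)
open import Data.Sum using (_⊎_; inj₁; inj₂)
open import Data.Vec using (Vec; []; _∷_; foldr; map; allFin; lookup; tabulate)
open import Data.Vec.Properties
  using (lookup-map; lookup-allFin; lookup∘tabulate; tabulate∘lookup; tabulate-cong; []=⇒lookup; lookup⇒[]=)
open import Function using (_∘_)
open import Function.Bundles using (Equivalence)
open import Relation.Binary.PropositionalEquality
open import Relation.Binary.Definitions using (tri<; tri≈; tri>)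
open import Relation.Nullary using (¬_; Dec; yes; no; does; ¬?)
open import Relation.Nullary.Decidable
  using (dec-true; decidable-stable; ¬¬-excluded-middle; map′; _×-dec_; _⊎-dec_; _→-dec_)
open import Algebra.Properties.CommutativeMonoid.Sum +-0-commutativeMonoid
  using (sum; sum-syntax; sum-cong-≗; ∑-distrib-+; ∑-comm)
open import Algebra.Properties.Semiring.Sum +-*-semiring using (*-distribˡ-sum; *-distribʳ-sum)

𝟙 : Bool → ℕ
𝟙 true = 1
𝟙 false = 0

count : ∀ {m} → (Fin m → Bool) → ℕ
count p = sum (𝟙 ∘ p)

_⊆ᵇ_ : ∀ {m} → (Fin m → Bool) → (Fin m → Bool) → Set
p ⊆ᵇ q = ∀ i → p i ≡ true → q i ≡ true

Disjointᵇ : ∀ {m} → (Fin m → Bool) → (Fin m → Bool) → Set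
Disjointᵇ p q = ∀ i → p i ≡ true → q i ≡ true → ⊥

does-true⇒ : ∀ {A : Set} (a? : Dec A) → does a? ≡ true → A
does-true⇒ (yes a) _ = a

∧-true : ∀ {a b} → a ≡ true → b ≡ true → (a ∧ b) ≡ true
∧-true refl refl = refl

∧-true⇒ˡ : ∀ a {b} → (a ∧ b) ≡ true → a ≡ true
∧-true⇒ˡ true _ = refl

∧-true⇒ʳ : ∀ a {b} → (a ∧ b) ≡ true → b ≡ true
∧-true⇒ʳ true b≡true = b≡true

∣tabulate∣≡count : ∀ {m} (p : Fin m → Bool) → ∣ tabulate p ∣ ≡ count p
∣tabulate∣≡count {zero} p = refl
∣tabulate∣≡count {suc m} p with p zero | ∣tabulate∣≡count (p ∘ suc)
... | true  | eq = cong suc eq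
... | false | eq = eq

sum-mono-≤ : ∀ {m} {f g : Fin m → ℕ} → (∀ i → f i ≤ g i) → sum f ≤ sum g
sum-mono-≤ {zero} f≤g = z≤n
sum-mono-≤ {suc m} f≤g = +-mono-≤ (f≤g zero) (sum-mono-≤ (f≤g ∘ suc))

≤-sum : ∀ {m} (f : Fin m → ℕ) i → f i ≤ sum f
≤-sum f zero = m≤m+n _ _
≤-sum f (suc i) = ≤-trans (≤-sum (f ∘ suc) i) (m≤n+m _ (f zero))

sum-const : ∀ m c → ∑[ i < m ] c ≡ m * c
sum-const zero c = refl
sum-const (suc m) c = cong (c +_) (sum-const m c)

sum-++ : ∀ m {k} (f : Fin (m + k) → ℕ) →
         sum f ≡ ∑[ i < m ] f (i ↑ˡ k) + ∑[ j < k ] f (m ↑ʳ j)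
sum-++ zero f = refl
sum-++ (suc m) f = trans (cong (f zero +_) (sum-++ m (f ∘ suc))) (sym (+-assoc (f zero) _ _))

sum-combine : ∀ {v n} (f : Fin (v * n) → ℕ) →
              sum f ≡ ∑[ x < v ] ∑[ j < n ] f (combine x j)
sum-combine {zero} f = refl
sum-combine {suc v} {n} f =
  trans (sum-++ n f) (cong (sum (f ∘ combine {suc v} zero) +_) (sum-combine {v} (f ∘ (n ↑ʳ_))))

𝟙-mono : ∀ {a b} → (a ≡ true → b ≡ true) → 𝟙 a ≤ 𝟙 b
𝟙-mono {false} _ = z≤n
𝟙-mono {true} a⇒b rewrite a⇒b refl = ≤-refl

count-cong : ∀ {m} {p q : Fin m → Bool} → (∀ i → p i ≡ q i) → count p ≡ count q
count-cong p≗q = sum-cong-≗ (cong 𝟙 ∘ p≗q)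

count-mono : ∀ {m} {p q : Fin m → Bool} → p ⊆ᵇ q → count p ≤ count q
count-mono p⊆q = sum-mono-≤ (λ i → 𝟙-mono (p⊆q i))

count-false : ∀ {m} (p : Fin m → Bool) → (∀ i → p i ≡ false) → count p ≡ 0
count-false {zero} p _ = refl
count-false {suc m} p none rewrite none zero = count-false (p ∘ suc) (none ∘ suc)

count≡0⇒false : ∀ {m} (p : Fin m → Bool) → count p ≡ 0 → ∀ i → p i ≡ false
count≡0⇒false p c≡0 i with p i in eq
... | false = refl
... | true with () ← subst (λ b → 𝟙 b ≤ 0) eq (subst (𝟙 (p i) ≤_) c≡0 (≤-sum (𝟙 ∘ p) i))

count-witness : ∀ {m} (p : Fin m → Bool) → 1 ≤ count p → ∃ λ i → p i ≡ true
count-witness {suc m} p pos with p zero in eq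
... | true = zero , eq
... | false with count-witness (p ∘ suc) pos
... | i , pi = suc i , pi

count≤1 : ∀ {m} (p : Fin m → Bool) → (∀ i j → p i ≡ true → p j ≡ true → i ≡ j) → count p ≤ 1
count≤1 {zero} p _ = z≤n
count≤1 {suc m} p unique with p zero in eq
... | true = ≤-reflexive (cong suc (count-false (p ∘ suc) rest-false))
  where
  rest-false : ∀ i → p (suc i) ≡ false
  rest-false i with p (suc i) in eq′
  ... | false = refl
  ... | true with () ← unique zero (suc i) eq eq′
... | false = count≤1 (p ∘ suc) (λ i j pi pj → Finₚ.suc-injective (unique (suc i) (suc j) pi pj))

count-⊆-antisym : ∀ {m} (p q : Fin m → Bool) → p ⊆ᵇ q → count q ≤ count p → ∀ i → p i ≡ q i
count-⊆-antisym p q p⊆q q≤p zero with p zero in eq | q zero in eq′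
... | true | true = refl
... | false | false = refl
... | true | false with () ← trans (sym (p⊆q zero eq)) eq′
... | false | true = ⊥-elim (<⇒≱ (s≤s (count-mono {p = p ∘ suc} {q ∘ suc} (p⊆q ∘ suc))) q≤p)
count-⊆-antisym p q p⊆q q≤p (suc i) = count-⊆-antisym (p ∘ suc) (q ∘ suc) (p⊆q ∘ suc)
  (+-cancelˡ-≤ (𝟙 (p zero)) _ _ (≤-trans (+-monoˡ-≤ _ (𝟙-mono (p⊆q zero))) q≤p)) i

count-∨ : ∀ {m} (p q : Fin m → Bool) → Disjointᵇ p q → count p + count q ≡ count (λ i → p i ∨ q i)
count-∨ p q disjoint = trans (sym (∑-distrib-+ (𝟙 ∘ p) (𝟙 ∘ q))) (sum-cong-≗ λ i → 𝟙-∨ (p i) (q i) (disjoint i))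
  where
  𝟙-∨ : ∀ a b → (a ≡ true → b ≡ true → ⊥) → 𝟙 a + 𝟙 b ≡ 𝟙 (a ∨ b)
  𝟙-∨ false b _ = refl
  𝟙-∨ true false _ = refl
  𝟙-∨ true true both = ⊥-elim (both refl refl)

count-∨-≤ : ∀ {m} (p q : Fin m → Bool) → count (λ i → p i ∨ q i) ≤ count p + count q
count-∨-≤ p q = ≤-trans (sum-mono-≤ (λ i → 𝟙-∨-≤ (p i) (q i))) (≤-reflexive (∑-distrib-+ (𝟙 ∘ p) (𝟙 ∘ q)))
  where
  𝟙-∨-≤ : ∀ a b → 𝟙 (a ∨ b) ≤ 𝟙 a + 𝟙 b
  𝟙-∨-≤ false b = ≤-refl
  𝟙-∨-≤ true false = ≤-refl
  𝟙-∨-≤ true true = s≤s z≤n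

count-+-≤ : ∀ {m} {p q r : Fin m → Bool} → Disjointᵇ p q → p ⊆ᵇ r → q ⊆ᵇ r → count p + count q ≤ count r
count-+-≤ {p = p} {q} disjoint p⊆r q⊆r = ≤-trans (≤-reflexive (count-∨ p q disjoint)) (count-mono ∨⊆r)
  where
  ∨⊆r : (λ i → p i ∨ q i) ⊆ᵇ _
  ∨⊆r i p∨q with p i in pi
  ... | true = p⊆r i pi
  ... | false = q⊆r i p∨q

sum-count-disjoint : ∀ {k m} (f : Fin k → Fin m → Bool) (q : Fin m → Bool) →
  (∀ a → f a ⊆ᵇ q) → (∀ i a b → f a i ≡ true → f b i ≡ true → a ≡ b) →
  ∑[ a < k ] count (f a) ≤ count q
sum-count-disjoint {k} {m} f q f⊆q unique = begin
  ∑[ a < k ] ∑[ i < m ] 𝟙 (f a i)  ≡⟨ ∑-comm (λ a i → 𝟙 (f a i)) ⟩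
  ∑[ i < m ] count (λ a → f a i)   ≤⟨ sum-mono-≤ column ⟩
  count q                          ∎
  where
  open ≤-Reasoning
  column : ∀ i → count (λ a → f a i) ≤ 𝟙 (q i)
  column i with q i in qi
  ... | true = count≤1 _ (unique i)
  ... | false = ≤-reflexive (count-false _ outside)
    where
    outside : ∀ a → f a i ≡ false
    outside a with f a i in fai
    ... | false = refl
    ... | true with () ← trans (sym (f⊆q a i fai)) qi

count-section : ∀ {v n} (p : Fin (v * n) → Bool) (τ : Fin v → Fin n) →
                count (λ x → p (combine x (τ x))) ≤ count p
count-section {v} {n} p τ = begin
  count (λ x → p (combine x (τ x)))          ≤⟨ sum-mono-≤ (λ x → ≤-sum (λ j → 𝟙 (p (combine x j))) (τ x)) ⟩
  ∑[ x < v ] ∑[ j < n ] 𝟙 (p (combine x j))  ≡⟨ sum-combine {v} {n} (𝟙 ∘ p) ⟨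
  count p                                    ∎
  where open ≤-Reasoning

lookup-false⇒∉ : ∀ {v} {S : Subset v} {x} → lookup S x ≡ false → x ∉ S
lookup-false⇒∉ eq x∈S with () ← trans (sym ([]=⇒lookup x∈S)) eq

∉⇒lookup-false : ∀ {v} {S : Subset v} {x} → x ∉ S → lookup S x ≡ false
∉⇒lookup-false {S = S} {x} x∉S with lookup S x in eq
... | true = ⊥-elim (x∉S (lookup⇒[]= x S eq))
... | false = refl

∣S∣≡count : ∀ {v} (S : Subset v) → ∣ S ∣ ≡ count (lookup S)
∣S∣≡count S = trans (cong ∣_∣ (sym (tabulate∘lookup S))) (∣tabulate∣≡count (lookup S))

isOdd : ℕ → Bool
isOdd zero = false
isOdd (suc n) = not (isOdd n)

isOdd-+ : ∀ m n → isOdd (m + n) ≡ isOdd m xor isOdd n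
isOdd-+ zero n = refl
isOdd-+ (suc m) n = trans (cong not (isOdd-+ m n)) (not-distribˡ-xor (isOdd m) (isOdd n))

isOdd-2* : ∀ k → isOdd (2 * k) ≡ false
isOdd-2* k = trans (cong isOdd (cong (k +_) (+-identityʳ k))) (trans (isOdd-+ k k) (xor-same (isOdd k)))

isOdd-+-2* : ∀ m k → isOdd (m + 2 * k) ≡ isOdd m
isOdd-+-2* m k = trans (isOdd-+ m (2 * k)) (trans (cong (isOdd m xor_) (isOdd-2* k)) (xor-identityʳ (isOdd m)))

isOdd-+-odd : ∀ m t → isOdd (m + suc (2 * t)) ≡ not (isOdd m)
isOdd-+-odd m t = begin
  isOdd (m + suc (2 * t))         ≡⟨ isOdd-+ m (suc (2 * t)) ⟩
  isOdd m xor not (isOdd (2 * t)) ≡⟨ cong (λ b → isOdd m xor not b) (isOdd-2* t) ⟩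
  isOdd m xor true                ≡⟨ not-distribʳ-xor (isOdd m) false ⟨
  not (isOdd m xor false)         ≡⟨ cong not (xor-identityʳ (isOdd m)) ⟩
  not (isOdd m)                   ∎
  where open ≡-Reasoning

suc-% : ∀ m n .{{_ : NonZero n}} → suc (m % n) % n ≡ suc m % n
suc-% m n = trans (%-distribˡ-+ 1 (m % n) n)
  (trans (cong (λ r → (1 % n + r) % n) (m%n%n≡m%n m n)) (sym (%-distribˡ-+ 1 m n)))

suc-%-injective : ∀ {i j n} .{{_ : NonZero n}} → i < n → j < n → suc i % n ≡ suc j % n → i ≡ j
suc-%-injective {i} {j} {n} i<n j<n eq with m≤n⇒m<n∨m≡n i<n | m≤n⇒m<n∨m≡n j<n
... | inj₁ i+1<n | inj₁ j+1<n = suc-injective (trans (sym (m<n⇒m%n≡m i+1<n)) (trans eq (m<n⇒m%n≡m j+1<n)))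
... | inj₂ i+1≡n | inj₂ j+1≡n = suc-injective (trans i+1≡n (sym j+1≡n))
... | inj₂ i+1≡n | inj₁ j+1<n with () ← trans (sym (trans (%-congˡ i+1≡n) (n%n≡0 n))) (trans eq (m<n⇒m%n≡m j+1<n))
... | inj₁ i+1<n | inj₂ j+1≡n with () ← trans (sym (trans (%-congˡ j+1≡n) (n%n≡0 n))) (trans (sym eq) (m<n⇒m%n≡m i+1<n))

n≤m<2n⇒m%n≡m∸n : ∀ {m n} .{{_ : NonZero n}} → n ≤ m → m < n + n → m % n ≡ m ∸ n
n≤m<2n⇒m%n≡m∸n {m} {n} n≤m m<2n = trans (sym (m≤n⇒[n∸m]%m≡n%m n≤m)) (m<n⇒m%n≡m m∸n<n)
  where
  m∸n<n : m ∸ n < n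
  m∸n<n = +-cancelʳ-< _ _ n (subst (_< n + n) (sym (m∸n+n≡m n≤m)) m<2n)

[r+e]%n≡r⇒e≡0 : ∀ {r e n} .{{_ : NonZero n}} → r < n → e < n → (r + e) % n ≡ r → e ≡ 0
[r+e]%n≡r⇒e≡0 {r} {e} {n} r<n e<n eq with r + e <? n
... | yes r+e<n = +-cancelˡ-≡ r e 0 (trans (sym (m<n⇒m%n≡m r+e<n)) (trans eq (sym (+-identityʳ r))))
... | no r+e≮n = ⊥-elim (<-irrefl e≡n e<n)
  where
  n≤r+e = ≮⇒≥ r+e≮n
  r+e∸n≡r : r + e ∸ n ≡ r
  r+e∸n≡r = trans (sym (n≤m<2n⇒m%n≡m∸n n≤r+e (+-mono-< r<n e<n))) eq
  e≡n : e ≡ n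
  e≡n = +-cancelˡ-≡ r e n (trans (sym (m∸n+n≡m n≤r+e)) (cong (_+ n) r+e∸n≡r))

module OddModulus (t : ℕ) where

  n : ℕ
  n = suc (2 * t)

  residue-window : ∀ {T T'} → T < T' → T' < T + 2 * n → T % n ≡ T' % n → T' ≡ T + n
  residue-window {T} {T'} T<T' T'<T+2n eq = trans (sym T+d≡T') (cong (T +_) d≡n)
    where
    d = T' ∸ T
    T+d≡T' : T + d ≡ T'
    T+d≡T' = m+[n∸m]≡n (<⇒≤ T<T')
    d%n≡0 : d % n ≡ 0
    d%n≡0 = [r+e]%n≡r⇒e≡0 (m%n<n T n) (m%n<n d n)
      (trans (sym (%-distribˡ-+ T d n)) (trans (%-congˡ T+d≡T') (sym eq)))
    d<2n : d < n + n
    d<2n = subst (d <_) (cong (n +_) (+-identityʳ n)) (+-cancelˡ-< T d (2 * n) (subst (_< T + 2 * n) (sym T+d≡T') T'<T+2n))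
    d≡n : d ≡ n
    d≡n with d <? n
    ... | yes d<n = ⊥-elim (<⇒≢ (m<n⇒0<n∸m T<T') (sym (trans (sym (m<n⇒m%n≡m d<n)) d%n≡0)))
    ... | no d≮n = ≤-antisym (m∸n≡0⇒m≤n (trans (sym (n≤m<2n⇒m%n≡m∸n (≮⇒≥ d≮n) d<2n)) d%n≡0)) (≮⇒≥ d≮n)

  residue-parity-window : ∀ {T T'} → T < T' → T' < T + 2 * n →
                          T % n ≡ T' % n → isOdd T ≡ isOdd T' → ⊥
  residue-parity-window {T} T<T' T'<T+2n eq parity =
    not-¬ refl (trans parity (trans (cong isOdd (residue-window T<T' T'<T+2n eq)) (isOdd-+-odd T t)))

  representative : ∀ {i} b → i < n → ∃ λ T → T < 2 * n × T % n ≡ i × isOdd T ≡ b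
  representative {i} b i<n with isOdd i ≟ᵇ b
  ... | yes same = i , ≤-trans i<n (m≤m+n n _) , m<n⇒m%n≡m i<n , same
  ... | no differ = i + n , i+n<2n , trans ([m+n]%n≡m%n i n) (m<n⇒m%n≡m i<n) ,
                    trans (isOdd-+-odd i t) (sym (¬-not (differ ∘ sym)))
    where
    i+n<2n : i + n < 2 * n
    i+n<2n = subst (i + n <_) (cong (n +_) (sym (+-identityʳ n))) (+-monoˡ-< n i<n)

squeeze-third : ∀ {d x y z} → d ≤ x → d ≤ y → x + y + z ≤ 2 * d → z ≡ 0
squeeze-third {d} {x} {y} {z} d≤x d≤y sum≤2d = n≤0⇒n≡0 (+-cancelˡ-≤ (d + d) z 0 (begin
  d + d + z ≤⟨ +-monoˡ-≤ z (+-mono-≤ d≤x d≤y) ⟩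
  x + y + z ≤⟨ sum≤2d ⟩
  d + (d + 0) ≡⟨ cong (d +_) (+-identityʳ d) ⟩
  d + d ≡⟨ +-identityʳ (d + d) ⟨
  d + d + 0 ∎))
  where open ≤-Reasoning

squeeze-pair : ∀ {d x y} → suc d ≤ x → d ≤ y → x + y ≤ 2 * d → ⊥
squeeze-pair {d} d<x d≤y sum≤2d = <-irrefl refl (begin-strict
  d + d       <⟨ +-monoˡ-< d d<x ⟩
  _           ≤⟨ +-monoʳ-≤ _ d≤y ⟩
  _           ≤⟨ sum≤2d ⟩
  d + (d + 0) ≡⟨ cong (d +_) (+-identityʳ d) ⟩
  d + d       ∎)
  where open ≤-Reasoning

pair-blocks-ordered : ∀ {j j' T T'} → j < j' → T ≤ suc (2 * j) → 2 * j' ≤ T' → T < T'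
pair-blocks-ordered {j} j<j' T≤ ≤T' =
  ≤-trans (s≤s T≤) (≤-trans (≤-reflexive (sym (*-suc 2 j))) (≤-trans (*-monoʳ-≤ 2 j<j') ≤T'))

pair-block-within : ∀ m {j T T'} → j < m → T' ≤ suc (2 * j) → T' < T + 2 * m
pair-block-within m {j} {T} j<m T'≤ =
  ≤-trans (s≤s T'≤) (≤-trans (≤-reflexive (sym (*-suc 2 j))) (≤-trans (*-monoʳ-≤ 2 j<m) (m≤n+m (2 * m) T)))

crossing : ∀ (P : ℕ → Set) → (∀ k → Dec (P k)) → ∀ {a b} → a ≤ b → P a → ¬ P b →
           ∃ λ k → a ≤ k × k < b × P k × ¬ P (suc k)
crossing P P? {a} {zero} a≤0 Pa ¬P0 with n≤0⇒n≡0 a≤0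
... | refl = ⊥-elim (¬P0 Pa)
crossing P P? {a} {suc b} a≤b+1 Pa ¬Pb+1 with m≤n⇒m<n∨m≡n a≤b+1
... | inj₂ refl = ⊥-elim (¬Pb+1 Pa)
... | inj₁ (s≤s a≤b) with P? b
...   | yes Pb = b , a≤b , ≤-refl , Pb , ¬Pb+1
...   | no ¬Pb with crossing P P? a≤b Pa ¬Pb
...     | k , a≤k , k<b , Pk , ¬Pk+1 = k , a≤k , m≤n⇒m≤1+n k<b , Pk , ¬Pk+1

periodic-window : ∀ (P : ℕ → Set) p → (∀ k → P k → P (k + p)) →
  ∀ {c T₀} → suc c < p → T₀ < p → P T₀ → ¬ P c → ¬ P (suc c) →
  ∃ λ T' → P T' × suc c < T' × T' < c + p
periodic-window P p up {c} {T₀} c+1<p T₀<p PT₀ ¬Pc ¬Pc+1 with suc c <? T₀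
... | yes c+1<T₀ = T₀ , PT₀ , c+1<T₀ , <-≤-trans T₀<p (m≤n+m p c)
... | no c+1≮T₀ = T₀ + p , up T₀ PT₀ , <-≤-trans c+1<p (m≤n+m p T₀) , +-monoˡ-< p T₀<c
  where
  T₀<c : T₀ < c
  T₀<c with m≤n⇒m<n∨m≡n (≮⇒≥ c+1≮T₀)
  ... | inj₂ refl = ⊥-elim (¬Pc+1 PT₀)
  ... | inj₁ (s≤s T₀≤c) with m≤n⇒m<n∨m≡n T₀≤c
  ...   | inj₁ T₀<c = T₀<c
  ...   | inj₂ refl = ⊥-elim (¬Pc PT₀)

periodic-crossings : ∀ (P : ℕ → Set) → (∀ k → Dec (P k)) → ∀ p →
  (∀ k → P k → P (k + p)) → (∀ k → P (k + p) → P k) →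
  ∀ {c T₀} → suc c < p → T₀ < p → P T₀ → ¬ P c → ¬ P (suc c) →
  ∃₂ λ a b → a < suc b × suc b < a + p × ¬ P a × P (suc a) × P b × ¬ P (suc b)
periodic-crossings P P? p up down c+1<p T₀<p PT₀ ¬Pc ¬Pc+1
  with periodic-window P p up c+1<p T₀<p PT₀ ¬Pc ¬Pc+1
... | T' , PT' , c+1<T' , T'<c+p
  with crossing (¬_ ∘ P) (¬? ∘ P?) (<⇒≤ c+1<T') ¬Pc+1 (λ ¬PT' → ¬PT' PT')
     | crossing P P? (<⇒≤ T'<c+p) PT' (¬Pc ∘ down _)
... | a , c+1≤a , a<T' , ¬Pa , ¬¬Pa+1 | b , T'≤b , b<c+p , Pb , ¬Pb+1 =
  a , b , m<n⇒m<1+n (<-≤-trans a<T' T'≤b) , <-≤-trans (s≤s b<c+p) (+-monoˡ-≤ p c+1≤a) ,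
  ¬Pa , decidable-stable (P? (suc a)) ¬¬Pa+1 , Pb , ¬Pb+1

¬¬-decidable-below : ∀ (P : ℕ → Set) m → ¬ ¬ (∀ k → k < m → Dec (P k))
¬¬-decidable-below P zero ¬dec = ¬dec (λ _ ())
¬¬-decidable-below P (suc m) ¬dec =
  ¬¬-decidable-below P m (λ dec<m → ¬¬-excluded-middle (λ P?m → ¬dec (extend dec<m P?m)))
  where
  extend : (∀ k → k < m → Dec (P k)) → Dec (P m) → ∀ k → k < suc m → Dec (P k)
  extend dec<m P?m k k<m+1 with m≤n⇒m<n∨m≡n k<m+1
  ... | inj₁ (s≤s k<m) = dec<m k k<m
  ... | inj₂ refl = P?m

≡ᵇ-true⇒≡ : ∀ {m n} → (m ≡ᵇ n) ≡ true → m ≡ n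
≡ᵇ-true⇒≡ {m} {n} eq = ≡ᵇ⇒≡ m n (Equivalence.from T-≡ eq)

≡⇒≡ᵇ-true : ∀ {m n} → m ≡ n → (m ≡ᵇ n) ≡ true
≡⇒≡ᵇ-true {m} {n} eq = Equivalence.to T-≡ (≡⇒≡ᵇ m n eq)

foldr-⊓-≤ : ∀ {m} b (xs : Vec ℕ m) i → foldr (λ _ → ℕ) _⊓_ b xs ≤ lookup xs i
foldr-⊓-≤ b (x ∷ xs) zero = m⊓n≤m x _
foldr-⊓-≤ b (x ∷ xs) (suc i) = ≤-trans (m⊓n≤n x _) (foldr-⊓-≤ b xs i)

foldr-⊓-attained : ∀ {m} b (xs : Vec ℕ (suc m)) → (∀ i → lookup xs i ≤ b) →
                   ∃ λ i → foldr (λ _ → ℕ) _⊓_ b xs ≡ lookup xs i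
foldr-⊓-attained {zero} b (x ∷ []) x≤b = zero , m≤n⇒m⊓n≡m (x≤b zero)
foldr-⊓-attained {suc m} b (x ∷ xs) xs≤b with foldr-⊓-attained b xs (xs≤b ∘ suc)
... | i , min≡xᵢ with ≤-total x (foldr (λ _ → ℕ) _⊓_ b xs)
...   | inj₁ x≤min = zero , m≤n⇒m⊓n≡m x≤min
...   | inj₂ min≤x = suc i , trans (m≥n⇒m⊓n≡n min≤x) min≡xᵢ

deg≡count : ∀ {v} (G : Graph v) x → deg G x ≡ count (G x)
deg≡count G x = ∣tabulate∣≡count (G x)

lookup-degrees : ∀ {v} (G : Graph v) x → lookup (map (deg G) (allFin v)) x ≡ deg G x
lookup-degrees G x = trans (lookup-map x (deg G) (allFin _)) (cong (deg G) (lookup-allFin x))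

δ≤deg : ∀ {v} (G : Graph v) x → δ G ≤ deg G x
δ≤deg {v} G x = subst (δ G ≤_) (lookup-degrees G x) (foldr-⊓-≤ v (map (deg G) (allFin v)) x)

δ-attained : ∀ {v} (G : Graph v) → 0 < v → ∃ λ x → deg G x ≡ δ G
δ-attained {suc v} G _ with foldr-⊓-attained (suc v) (map (deg G) (allFin (suc v)))
                              (λ x → subst (_≤ suc v) (sym (lookup-degrees G x)) (∣p∣≤n (N G x)))
... | x , δ≡ = x , sym (trans δ≡ (lookup-degrees G x))

module _ {m : ℕ} where

  Cycle-sym : ∀ i j → Cycle (suc m) i j ≡ Cycle (suc m) j i
  Cycle-sym i j = ∨-comm ((suc (toℕ i) % suc m) ≡ᵇ toℕ j) ((suc (toℕ j) % suc m) ≡ᵇ toℕ i)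

  Cycle-next : ∀ i j → toℕ j ≡ suc (toℕ i) % suc m → Cycle (suc m) i j ≡ true
  Cycle-next i j eq rewrite ≡⇒≡ᵇ-true (sym eq) = refl

  Cycle-prev : ∀ i j → toℕ i ≡ suc (toℕ j) % suc m → Cycle (suc m) i j ≡ true
  Cycle-prev i j eq rewrite ≡⇒≡ᵇ-true (sym eq) = ∨-zeroʳ _

  Cycle-adjacent : ∀ i j → Cycle (suc m) i j ≡ true →
                   toℕ j ≡ suc (toℕ i) % suc m ⊎ toℕ i ≡ suc (toℕ j) % suc m
  Cycle-adjacent i j adj with (suc (toℕ i) % suc m) ≡ᵇ toℕ j in next
  ... | true = inj₁ (sym (≡ᵇ-true⇒≡ next))
  ... | false = inj₂ (sym (≡ᵇ-true⇒≡ adj))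

  Cycle-deg≤2 : ∀ i → deg (Cycle (suc m)) i ≤ 2
  Cycle-deg≤2 i = begin
    deg (Cycle (suc m)) i                 ≡⟨ deg≡count (Cycle (suc m)) i ⟩
    count (λ j → next j ∨ prev j)         ≤⟨ count-∨-≤ next prev ⟩
    count next + count prev               ≤⟨ +-mono-≤ (count≤1 next next-unique) (count≤1 prev prev-unique) ⟩
    2                                     ∎
    where
    open ≤-Reasoning
    next prev : Fin (suc m) → Bool
    next j = (suc (toℕ i) % suc m) ≡ᵇ toℕ j
    prev j = (suc (toℕ j) % suc m) ≡ᵇ toℕ i
    next-unique : ∀ j k → next j ≡ true → next k ≡ true → j ≡ k
    next-unique j k j-next k-next =
      Finₚ.toℕ-injective (trans (sym (≡ᵇ-true⇒≡ {suc (toℕ i) % suc m} j-next)) (≡ᵇ-true⇒≡ k-next))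
    prev-unique : ∀ j k → prev j ≡ true → prev k ≡ true → j ≡ k
    prev-unique j k j-prev k-prev = Finₚ.toℕ-injective
      (suc-%-injective (Finₚ.toℕ<n j) (Finₚ.toℕ<n k)
        (trans (≡ᵇ-true⇒≡ {suc (toℕ j) % suc m} j-prev) (sym (≡ᵇ-true⇒≡ {suc (toℕ k) % suc m} k-prev))))

module _ {v} {G : Graph v} {S : Subset v} where

  Reach-source∉ : ∀ {x y} → Reach G S x y → x ∉ S
  Reach-source∉ (here x∉S) = x∉S
  Reach-source∉ (step x∉S _ _) = x∉S

  Reach-target∉ : ∀ {x y} → Reach G S x y → y ∉ S
  Reach-target∉ (here y∉S) = y∉S
  Reach-target∉ (step _ _ walk) = Reach-target∉ walk

  Reach-trans : ∀ {x y z} → Reach G S x y → Reach G S y z → Reach G S x z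
  Reach-trans (here _) walk′ = walk′
  Reach-trans (step x∉S adj walk) walk′ = step x∉S adj (Reach-trans walk walk′)

  Reach-snoc : ∀ {x y z} → Reach G S x y → G y z ≡ true → z ∉ S → Reach G S x z
  Reach-snoc walk adj z∉S = Reach-trans walk (step (Reach-target∉ walk) adj (here z∉S))

  Reach-sym : (∀ x y → G x y ≡ G y x) → ∀ {x y} → Reach G S x y → Reach G S y x
  Reach-sym sym-G (here x∉S) = here x∉S
  Reach-sym sym-G (step x∉S adj walk) = Reach-snoc (Reach-sym sym-G walk) (trans (sym-G _ _) adj) x∉S

  Reach-neighbour : ∀ {x y} → Reach G S x y → x ≢ y → ∃ λ z → G x z ≡ true
  Reach-neighbour (here _) x≢x = ⊥-elim (x≢x refl)
  Reach-neighbour (step _ adj _) _ = _ , adj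

Reach-map : ∀ {v w} {G : Graph v} {K : Graph w} {S : Subset v} {U : Subset w}
  (f : Fin v → Fin w) → (∀ x y → G x y ≡ true → K (f x) (f y) ≡ true) →
  (∀ x → x ∉ S → f x ∉ U) → ∀ {x y} → Reach G S x y → Reach K U (f x) (f y)
Reach-map f hom avoid (here x∉S) = here (avoid _ x∉S)
Reach-map f hom avoid (step x∉S adj walk) = step (avoid _ x∉S) (hom _ _ adj) (Reach-map f hom avoid walk)

bipartition-flip : ∀ {v} {G : Graph v} {side : Fin v → Bool} → IsBipartition G side →
                   ∀ {x y} → G x y ≡ true → side y ≡ not (side x)
bipartition-flip bip {x} {y} adj = ¬-not (λ same → bip x y adj (sym same))

module _ {v w} (G : Graph v) (K : Graph w) where

  ×ᵍ-combine : ∀ x i y j → (G ×ᵍ K) (combine x i) (combine y j) ≡ (G x y ∧ K i j)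
  ×ᵍ-combine x i y j = cong₂ (λ p q → G (proj₁ p) (proj₁ q) ∧ K (proj₂ p) (proj₂ q))
                              (Finₚ.remQuot-combine x i) (Finₚ.remQuot-combine y j)

  ×ᵍ-sym : (∀ x y → G x y ≡ G y x) → (∀ i j → K i j ≡ K j i) → ∀ p q → (G ×ᵍ K) p q ≡ (G ×ᵍ K) q p
  ×ᵍ-sym sym-G sym-K p q = cong₂ _∧_ (sym-G _ _) (sym-K _ _)

  deg-×ᵍ : ∀ x i → deg (G ×ᵍ K) (combine x i) ≡ deg G x * deg K i
  deg-×ᵍ x i = begin
    deg (G ×ᵍ K) (combine x i)                                   ≡⟨ deg≡count (G ×ᵍ K) (combine x i) ⟩
    count ((G ×ᵍ K) (combine x i))                               ≡⟨ sum-combine {v} {w} (𝟙 ∘ (G ×ᵍ K) (combine x i)) ⟩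
    ∑[ y < v ] ∑[ j < w ] 𝟙 ((G ×ᵍ K) (combine x i) (combine y j))
      ≡⟨ sum-cong-≗ (λ y → sum-cong-≗ (λ j → factor y j)) ⟩
    ∑[ y < v ] ∑[ j < w ] (𝟙 (G x y) * 𝟙 (K i j))
      ≡⟨ sum-cong-≗ (λ y → *-distribˡ-sum (𝟙 (G x y)) (𝟙 ∘ K i)) ⟨
    ∑[ y < v ] (𝟙 (G x y) * count (K i))                         ≡⟨ *-distribʳ-sum (count (K i)) (𝟙 ∘ G x) ⟨
    count (G x) * count (K i)                                    ≡⟨ cong₂ _*_ (deg≡count G x) (deg≡count K i) ⟨
    deg G x * deg K i                                            ∎
    where
    open ≡-Reasoning
    𝟙-∧ : ∀ a b → 𝟙 (a ∧ b) ≡ 𝟙 a * 𝟙 b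
    𝟙-∧ false b = refl
    𝟙-∧ true false = refl
    𝟙-∧ true true = refl
    factor : ∀ y j → 𝟙 ((G ×ᵍ K) (combine x i) (combine y j)) ≡ 𝟙 (G x y) * 𝟙 (K i j)
    factor y j = trans (cong 𝟙 (×ᵍ-combine x i y j)) (𝟙-∧ (G x y) (K i j))

Reach-from-centre : ∀ {v} {G : Graph v} {x y} → Reach G (N G x) x y → x ≡ y
Reach-from-centre (here _) = refl
Reach-from-centre {G = G} (step _ adj walk) =
  ⊥-elim (Reach-source∉ walk (lookup⇒[]= _ (N G _) (trans (lookup∘tabulate (G _) _) adj)))

N-cut : ∀ {v} (G : Graph v) → (∀ x → G x x ≡ false) → ∀ {x y} → x ≢ y → G x y ≡ false → IsCut G (N G x)
N-cut G loopless {x} {y} x≢y nonadjacent =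
  x , y , lookup-false⇒∉ (trans (lookup∘tabulate (G x) x) (loopless x)) ,
  lookup-false⇒∉ (trans (lookup∘tabulate (G x) y) nonadjacent) , x≢y ∘ Reach-from-centre

saturated⇒≡N : ∀ {v} (G : Graph v) (S : Subset v) z → ∣ S ∣ ≤ δ G →
               (∀ q → G z q ≡ true → lookup S q ≡ true) → deg G z ≡ δ G × S ≡ N G z
saturated⇒≡N G S z ∣S∣≤δ N⊆S = ≤-antisym deg≤δ (δ≤deg G z) , S≡N
  where
  open ≤-Reasoning
  count-S≤deg : count (lookup S) ≤ count (G z)
  count-S≤deg = begin
    count (lookup S) ≡⟨ ∣S∣≡count S ⟨
    ∣ S ∣            ≤⟨ ∣S∣≤δ ⟩
    δ G              ≤⟨ δ≤deg G z ⟩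
    deg G z          ≡⟨ deg≡count G z ⟩
    count (G z)      ∎
  deg≤δ : deg G z ≤ δ G
  deg≤δ = begin
    deg G z          ≡⟨ deg≡count G z ⟩
    count (G z)      ≤⟨ count-mono N⊆S ⟩
    count (lookup S) ≡⟨ ∣S∣≡count S ⟨
    ∣ S ∣            ≤⟨ ∣S∣≤δ ⟩
    δ G              ∎
  S≡N : S ≡ N G z
  S≡N = trans (sym (tabulate∘lookup S)) (tabulate-cong (λ q → sym (count-⊆-antisym (G z) (lookup S) N⊆S count-S≤deg q)))

sideClass : ∀ {v} → (Fin v → Bool) → Bool → Fin v → Bool
sideClass side b y = does (side y ≟ᵇ b)

min-cut≤δ : ∀ {v} (G : Graph v) → (∀ x → G x x ≡ false) → (∀ x → ∃ λ y → x ≢ y × G x y ≡ false) →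
            0 < v → ∀ {S} → IsMinCut G S → ∣ S ∣ ≤ δ G
min-cut≤δ G loopless non-universal 0<v (_ , minimal) with δ-attained G 0<v
... | x , deg≡δ with non-universal x
...   | y , x≢y , nonadjacent = ≤-trans (minimal (N G x) (N-cut G loopless x≢y nonadjacent)) (≤-reflexive deg≡δ)

δ≥1 : ∀ {v} (G : Graph v) → 0 < v → (∀ x → ∃ λ y → G x y ≡ true) → 1 ≤ δ G
δ≥1 G 0<v no-isolated with δ-attained G 0<v
... | x , deg≡δ with no-isolated x
...   | y , adjacent = subst (1 ≤_) (trans (sym (deg≡count G x)) deg≡δ)
                             (subst (λ b → 𝟙 b ≤ count (G x)) adjacent (≤-sum (𝟙 ∘ G x) y))

complete-bipartite-class≤1 : ∀ {v} {G : Graph v} {side} → IsComplete G → IsBipartition G side →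
                             ∀ b → count (sideClass side b) ≤ 1
complete-bipartite-class≤1 {side = side} complete bip b = count≤1 _ same-class⇒≡
  where
  same-class⇒≡ : ∀ x y → sideClass side b x ≡ true → sideClass side b y ≡ true → x ≡ y
  same-class⇒≡ x y x∈b y∈b with x Finₚ.≟ y
  ... | yes x≡y = x≡y
  ... | no x≢y = ⊥-elim (bip x y (complete x y x≢y)
                   (trans (does-true⇒ (side x ≟ᵇ b) x∈b) (sym (does-true⇒ (side y ≟ᵇ b) y∈b))))

Fin-other : ∀ {m} → 2 ≤ m → (i : Fin m) → ∃ λ j → i ≢ j
Fin-other {suc zero} (s≤s ()) _
Fin-other {suc (suc _)} _ i = punchIn i zero , Finₚ.punchInᵢ≢i i zero ∘ sym

∣X∣≡count-class : ∀ {v} (side : Fin v → Bool) → ∣ X side ∣ ≡ count (sideClass side false)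
∣X∣≡count-class side = trans (∣tabulate∣≡count (not ∘ side)) (count-cong (class-false ∘ side))
  where
  class-false : ∀ b → not b ≡ does (b ≟ᵇ false)
  class-false false = refl
  class-false true = refl

∣Y∣≡count-class : ∀ {v} (side : Fin v → Bool) → ∣ Y side ∣ ≡ count (sideClass side true)
∣Y∣≡count-class side = trans (∣tabulate∣≡count side) (count-cong (class-true ∘ side))
  where
  class-true : ∀ b → b ≡ does (b ≟ᵇ true)
  class-true false = refl
  class-true true = refl

connected-bipartite-no-isolated : ∀ {v} {G : Graph v} {side} → Connected G →
  (∀ b → 1 ≤ count (sideClass side b)) → ∀ x → ∃ λ y → G x y ≡ true
connected-bipartite-no-isolated {G = G} {side} conn classes-inhabited x
  with count-witness (sideClass side (not (side x))) (classes-inhabited (not (side x)))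
... | y , y∈class = Reach-neighbour (conn x y) x≢y
  where
  x≢y : x ≢ y
  x≢y refl = not-¬ refl (does-true⇒ (side x ≟ᵇ not (side x)) y∈class)

connectivity≤cut : ∀ {v} {G : Graph v} {κ} → IsConnectivity G κ → ¬ IsComplete G → ∀ T → IsCut G T → κ ≤ ∣ T ∣
connectivity≤cut (inj₁ (complete , _)) incomplete = ⊥-elim (incomplete complete)
connectivity≤cut (inj₂ (_ , S , (_ , minimal) , ∣S∣≡κ)) _ T T-cut = subst (_≤ ∣ T ∣) ∣S∣≡κ (minimal T T-cut)

module OddCycleProduct {v : ℕ} (G : Graph v) (side : Fin v → Bool) (t : ℕ)
  (sym-G : ∀ x y → G x y ≡ G y x) (bip : IsBipartition G side) where

  open OddModulus t public

  H : Graph (v * n)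
  H = G ×ᵍ Cycle n

  vertex : Fin (v * n) → Fin v
  vertex q = proj₁ (remQuot {v} n q)

  index : Fin (v * n) → Fin n
  index q = proj₂ (remQuot {v} n q)

  vertex-combine : ∀ (x : Fin v) (i : Fin n) → vertex (combine x i) ≡ x
  vertex-combine x i = cong proj₁ (Finₚ.remQuot-combine x i)

  index-combine : ∀ (x : Fin v) (i : Fin n) → index (combine x i) ≡ i
  index-combine x i = cong proj₂ (Finₚ.remQuot-combine x i)

  H-at : ∀ q (y : Fin v) (j : Fin n) → H q (combine y j) ≡ (G (vertex q) y ∧ Cycle n (index q) j)
  H-at q y j = cong₂ (λ y′ j′ → G (vertex q) y′ ∧ Cycle n (index q) j′) (vertex-combine y j) (index-combine y j)

  H-sym : ∀ p q → H p q ≡ H q p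
  H-sym = ×ᵍ-sym G (Cycle n) sym-G Cycle-sym

  record InLayer (T : ℕ) (q : Fin (v * n)) : Set where
    constructor at
    field
      residue : toℕ (index q) ≡ T % n
      parity : side (vertex q) ≡ isOdd T

  inLayer? : ∀ T q → Dec (InLayer T q)
  inLayer? T q = map′ (λ (i≡T , side≡) → at i≡T side≡) (λ (at i≡T side≡) → i≡T , side≡)
                      ((toℕ (index q) ≟ T % n) ×-dec (side (vertex q) ≟ᵇ isOdd T))

  layer : ℕ → Fin (v * n) → Bool
  layer T q = does (inLayer? T q)

  InLayer-combine : ∀ {T} {x : Fin v} {i : Fin n} → toℕ i ≡ T % n → side x ≡ isOdd T → InLayer T (combine x i)
  InLayer-combine {x = x} {i} i≡T side≡ =
    at (trans (cong toℕ (index-combine x i)) i≡T) (trans (cong side (vertex-combine x i)) side≡)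

  InLayer-cong : ∀ {T T' q} → T % n ≡ T' % n → isOdd T ≡ isOdd T' → InLayer T q → InLayer T' q
  InLayer-cong ≡mod ≡parity (at i≡T side≡) = at (trans i≡T ≡mod) (trans side≡ ≡parity)

  InLayer-window : ∀ {T T' q} → T < T' → T' < T + 2 * n → InLayer T q → InLayer T' q → ⊥
  InLayer-window T<T' T'<T+2n (at i≡T side≡) (at i≡T' side≡') =
    residue-parity-window T<T' T'<T+2n (trans (sym i≡T) i≡T') (trans (sym side≡) side≡')

  slot : ℕ → Fin n
  slot T = fromℕ< (m%n<n T n)

  toℕ-slot : ∀ T → toℕ (slot T) ≡ T % n
  toℕ-slot T = Finₚ.toℕ-fromℕ< (m%n<n T n)

  slot-suc : ∀ T → toℕ (slot (suc T)) ≡ suc (toℕ (slot T)) % n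
  slot-suc T = trans (toℕ-slot (suc T)) (trans (sym (suc-% T n)) (cong (λ r → suc r % n) (sym (toℕ-slot T))))

  lift-forward : ∀ {T q} {y : Fin v} → InLayer T q → G (vertex q) y ≡ true →
                 H q (combine y (slot (suc T))) ≡ true × InLayer (suc T) (combine y (slot (suc T)))
  lift-forward {T} {q} {y} (at i≡T side≡) adj =
    trans (H-at q y _) (∧-true adj (Cycle-next _ _ index-step)) ,
    InLayer-combine {suc T} (toℕ-slot (suc T)) (trans (bipartition-flip bip adj) (cong not side≡))
    where
    index-step : toℕ (slot (suc T)) ≡ suc (toℕ (index q)) % n
    index-step = trans (slot-suc T) (cong (λ r → suc r % n) (trans (toℕ-slot T) (sym i≡T)))

  lift-backward : ∀ {T q} {y : Fin v} → InLayer (suc T) q → G (vertex q) y ≡ true →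
                  H q (combine y (slot T)) ≡ true × InLayer T (combine y (slot T))
  lift-backward {T} {q} {y} (at i≡T+1 side≡) adj =
    trans (H-at q y _) (∧-true adj (Cycle-prev _ _ (trans i≡T+1 (trans (sym (toℕ-slot (suc T))) (slot-suc T))))) ,
    InLayer-combine {T} (toℕ-slot T) (trans (bipartition-flip bip adj) (trans (cong not side≡) (not-involutive (isOdd T))))

  neighbour-layers : ∀ {T q q'} → InLayer (suc T) q → H q q' ≡ true → InLayer T q' ⊎ InLayer (suc (suc T)) q'
  neighbour-layers {T} {q} {q'} (at i≡T+1 side≡) adj
    with Cycle-adjacent (index q) (index q') (∧-true⇒ʳ (G (vertex q) (vertex q')) adj)
  ... | inj₁ next = inj₂ (at (trans next (trans (cong (λ r → suc r % n) i≡T+1) (suc-% (suc T) n))) side′)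
    where side′ = trans (bipartition-flip bip (∧-true⇒ˡ _ adj)) (cong not side≡)
  ... | inj₂ prev = inj₁ (at (suc-%-injective (Finₚ.toℕ<n (index q')) (m%n<n T n)
                                               (trans (sym prev) (trans i≡T+1 (sym (suc-% T n)))))
                            (trans (bipartition-flip bip (∧-true⇒ˡ _ adj)) (trans (cong not side≡) (not-involutive (isOdd T)))))

  module Block (B : ℕ) where

    slotOf : Bool → Fin n
    slotOf b with b ≟ᵇ isOdd B
    ... | yes _ = slot B
    ... | no _ = slot (suc B)

    slotOf-spec : ∀ b → (b ≡ isOdd B × slotOf b ≡ slot B) ⊎ (b ≡ isOdd (suc B) × slotOf b ≡ slot (suc B))
    slotOf-spec b with b ≟ᵇ isOdd B
    ... | yes b≡ = inj₁ (b≡ , refl)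
    ... | no b≢ = inj₂ (¬-not b≢ , refl)

    embed : Fin v → Fin (v * n)
    embed x = combine x (slotOf (side x))

    embed-InLayer : ∀ (x : Fin v) → InLayer B (embed x) ⊎ InLayer (suc B) (embed x)
    embed-InLayer x with slotOf-spec (side x)
    ... | inj₁ (side≡ , slot≡) = inj₁ (InLayer-combine {B} (trans (cong toℕ slot≡) (toℕ-slot B)) side≡)
    ... | inj₂ (side≡ , slot≡) = inj₂ (InLayer-combine {suc B} (trans (cong toℕ slot≡) (toℕ-slot (suc B))) side≡)

    embed-vertex : ∀ q → InLayer B q ⊎ InLayer (suc B) q → embed (vertex q) ≡ q
    embed-vertex q q∈block =
      trans (cong (combine (vertex q)) (Finₚ.toℕ-injective (same-slot q∈block (slotOf-spec (side (vertex q))))))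
            (Finₚ.combine-remQuot {v} n q)
      where
      same-slot : InLayer B q ⊎ InLayer (suc B) q → _ → toℕ (slotOf (side (vertex q))) ≡ toℕ (index q)
      same-slot (inj₁ (at i≡ _)) (inj₁ (_ , slot≡)) = trans (cong toℕ slot≡) (trans (toℕ-slot B) (sym i≡))
      same-slot (inj₂ (at i≡ _)) (inj₂ (_ , slot≡)) = trans (cong toℕ slot≡) (trans (toℕ-slot (suc B)) (sym i≡))
      same-slot (inj₁ (at _ side≡)) (inj₂ (side≡′ , _)) = ⊥-elim (not-¬ refl (trans (sym side≡) side≡′))
      same-slot (inj₂ (at _ side≡)) (inj₁ (side≡′ , _)) = ⊥-elim (not-¬ refl (trans (sym side≡′) side≡))

    embed-edge : ∀ (x y : Fin v) → G x y ≡ true → H (embed x) (embed y) ≡ true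
    embed-edge x y adj = trans (×ᵍ-combine G (Cycle n) x _ y _) (∧-true adj (cycle-step (slotOf-spec (side x)) (slotOf-spec (side y))))
      where
      sides-differ = bipartition-flip bip adj
      cycle-step : _ → _ → Cycle n (slotOf (side x)) (slotOf (side y)) ≡ true
      cycle-step (inj₁ (_ , sx)) (inj₂ (_ , sy)) =
        Cycle-next _ _ (subst₂ (λ i j → toℕ j ≡ suc (toℕ i) % n) (sym sx) (sym sy) (slot-suc B))
      cycle-step (inj₂ (_ , sx)) (inj₁ (_ , sy)) =
        Cycle-prev _ _ (subst₂ (λ i j → toℕ i ≡ suc (toℕ j) % n) (sym sx) (sym sy) (slot-suc B))
      cycle-step (inj₁ (bx , _)) (inj₁ (by , _)) = ⊥-elim (not-¬ refl (sym (trans (sym sides-differ) (trans by (sym bx)))))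
      cycle-step (inj₂ (bx , _)) (inj₂ (by , _)) = ⊥-elim (not-¬ refl (sym (trans (sym sides-differ) (trans by (sym bx)))))

  module Cut (S : Subset (v * n)) where

    Touches : Fin (v * n) → ℕ → Set
    Touches r T = ∃ λ q → InLayer T q × Reach H S r q

    Touches-cong : ∀ {r T T'} → T % n ≡ T' % n → isOdd T ≡ isOdd T' → Touches r T → Touches r T'
    Touches-cong ≡mod ≡parity (q , q∈L , walk) = q , InLayer-cong ≡mod ≡parity q∈L , walk

    Touches-+2n : ∀ {r} T → Touches r T → Touches r (T + 2 * n)
    Touches-+2n T = Touches-cong (sym ([m+kn]%n≡m%n T 2 n)) (sym (isOdd-+-2* T n))

    Touches-∸2n : ∀ {r} T → Touches r (T + 2 * n) → Touches r T
    Touches-∸2n T = Touches-cong ([m+kn]%n≡m%n T 2 n) (isOdd-+-2* T n)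

    Separate : ℕ → ℕ → Set
    Separate T T' = ∀ q → InLayer T q → InLayer T' q → ⊥

    touched-untouched-separate : ∀ {r T T'} → Touches r T → ¬ Touches r T' → Separate T T'
    touched-untouched-separate touch ¬touch q (at i≡T side≡) (at i≡T' side≡') =
      ¬touch (Touches-cong (trans (sym i≡T) i≡T') (trans (sym side≡) side≡') touch)

    -- Reachability in H − S is not decided constructively here; as every use has goal ⊥,
    -- decidability under a double negation is enough.
    ¬¬-Touches-decidable : ∀ r → ¬ ¬ (∀ T → Dec (Touches r T))
    ¬¬-Touches-decidable r ¬dec = ¬¬-decidable-below (Touches r) (2 * n) (¬dec ∘ extend)
      where
      extend : (∀ T → T < 2 * n → Dec (Touches r T)) → ∀ T → Dec (Touches r T)
      extend dec<2n T with representative (isOdd T) (m%n<n T n)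
      ... | T₀ , T₀<2n , T₀≡T , parity with dec<2n T₀ T₀<2n
      ...   | yes touch = yes (Touches-cong T₀≡T parity touch)
      ...   | no ¬touch = no (¬touch ∘ Touches-cong (sym T₀≡T) (sym parity))

    S∩L : ℕ → Fin (v * n) → Bool
    S∩L T q = lookup S q ∧ layer T q

    ∣S∩L∣ : ℕ → ℕ
    ∣S∩L∣ T = count (S∩L T)

    Saturated : Fin (v * n) → Set
    Saturated z = ∀ q → H z q ≡ true → lookup S q ≡ true

    untouched-neighbour∈S : ∀ {r q q' T} → Reach H S r q → H q q' ≡ true → InLayer T q' → ¬ Touches r T →
                            lookup S q' ≡ true
    untouched-neighbour∈S {q' = q'} walk adj q'∈L ¬touch with lookup S q' in q'∈S
    ... | true = refl
    ... | false = ⊥-elim (¬touch (q' , q'∈L , Reach-snoc walk adj (lookup-false⇒∉ q'∈S)))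

    in-S∩L : ∀ {T q} → lookup S q ≡ true → InLayer T q → S∩L T q ≡ true
    in-S∩L {T} {q} q∈S q∈L = ∧-true q∈S (dec-true (inLayer? T q) q∈L)

    δ≤∣S∩L∣ : ∀ {T x} (i : Fin n) →
              (∀ y → G x y ≡ true → lookup S (combine y i) ≡ true × InLayer T (combine y i)) → δ G ≤ ∣S∩L∣ T
    δ≤∣S∩L∣ {T} {x} i N⊆S∩L = begin
      δ G                                          ≤⟨ δ≤deg G x ⟩
      deg G x                                      ≡⟨ deg≡count G x ⟩
      count (G x)                                  ≤⟨ count-mono {q = λ (y : Fin v) → S∩L T (combine y i)} into-S∩L ⟩
      count (λ (y : Fin v) → S∩L T (combine y i))  ≤⟨ count-section {v} {n} (S∩L T) (λ _ → i) ⟩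
      ∣S∩L∣ T                                      ∎
      where
      open ≤-Reasoning
      into-S∩L : ∀ y → G x y ≡ true → S∩L T (combine y i) ≡ true
      into-S∩L y adj = in-S∩L (proj₁ (N⊆S∩L y adj)) (proj₂ (N⊆S∩L y adj))

    δ≤∣S∩L∣-ahead : ∀ {r T} → Touches r T → ¬ Touches r (suc T) → δ G ≤ ∣S∩L∣ (suc T)
    δ≤∣S∩L∣-ahead (q , q∈L , walk) ¬touch = δ≤∣S∩L∣ _ λ y adj →
      let (adj′ , y∈L) = lift-forward q∈L adj in untouched-neighbour∈S walk adj′ y∈L ¬touch , y∈L

    δ≤∣S∩L∣-behind : ∀ {r T} → ¬ Touches r T → Touches r (suc T) → δ G ≤ ∣S∩L∣ T
    δ≤∣S∩L∣-behind ¬touch (q , q∈L , walk) = δ≤∣S∩L∣ _ λ y adj →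
      let (adj′ , y∈L) = lift-backward q∈L adj in untouched-neighbour∈S walk adj′ y∈L ¬touch , y∈L

    saturated-between-untouched : ∀ {r T} → ¬ Touches r T → Touches r (suc T) → ¬ Touches r (suc (suc T)) →
                                  ∃ Saturated
    saturated-between-untouched ¬touch (q , q∈L , walk) ¬touch″ = q , λ q' adj → into-S (neighbour-layers q∈L adj) adj
      where
      into-S : ∀ {q'} → InLayer _ q' ⊎ InLayer _ q' → H q q' ≡ true → lookup S q' ≡ true
      into-S (inj₁ q'∈L) adj = untouched-neighbour∈S walk adj q'∈L ¬touch
      into-S (inj₂ q'∈L) adj = untouched-neighbour∈S walk adj q'∈L ¬touch″

    ∣S∩L∣≡0⇒∉ : ∀ {T q} → ∣S∩L∣ T ≡ 0 → InLayer T q → q ∉ S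
    ∣S∩L∣≡0⇒∉ {T} {q} empty q∈L = lookup-false⇒∉ (begin
      lookup S q                 ≡⟨ ∧-identityʳ (lookup S q) ⟨
      lookup S q ∧ true          ≡⟨ cong (lookup S q ∧_) (dec-true (inLayer? T q) q∈L) ⟨
      lookup S q ∧ layer T q     ≡⟨ count≡0⇒false _ empty q ⟩
      false                      ∎)
      where open ≡-Reasoning

    side-class≤∣S∩L∣ : Connected G → (∀ x → ∃ λ y → G x y ≡ true) → ∀ {r T} →
      ¬ Touches r T → Touches r (suc T) → ∣S∩L∣ (suc T) ≡ 0 → ∣S∩L∣ (suc (suc T)) ≡ 0 →
      count (sideClass side (isOdd T)) ≤ ∣S∩L∣ T
    side-class≤∣S∩L∣ conn no-isolated {r} {T} ¬touch (q , q∈L , walk) empty empty′ = begin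
      count (sideClass side (isOdd T))                    ≤⟨ count-mono {q = λ (y : Fin v) → S∩L T (combine y (slot T))} covered ⟩
      count (λ (y : Fin v) → S∩L T (combine y (slot T))) ≤⟨ count-section {v} {n} (S∩L T) (λ _ → slot T) ⟩
      ∣S∩L∣ T                                         ∎
      where
      open ≤-Reasoning
      open Block (suc T)
      embed∉S : ∀ x → embed x ∉ S
      embed∉S x with embed-InLayer x
      ... | inj₁ x∈L = ∣S∩L∣≡0⇒∉ empty x∈L
      ... | inj₂ x∈L = ∣S∩L∣≡0⇒∉ empty′ x∈L
      reaches : ∀ x → Reach H S r (embed x)
      reaches x = Reach-trans (subst (Reach H S r) (sym (embed-vertex q (inj₁ q∈L))) walk)
                              (Reach-map embed embed-edge (λ x _ → embed∉S x) (conn (vertex q) x))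
      covered : ∀ y → sideClass side (isOdd T) y ≡ true → S∩L T (combine y (slot T)) ≡ true
      covered y y∈class = in-S∩L (untouched-neighbour∈S (reaches z) (proj₁ lifted) (proj₂ lifted) ¬touch) (proj₂ lifted)
        where
        z = proj₁ (no-isolated y)
        side-z : side z ≡ not (isOdd T)
        side-z = trans (bipartition-flip bip (proj₂ (no-isolated y))) (cong not (does-true⇒ (side y ≟ᵇ isOdd T) y∈class))
        z∈L : InLayer (suc T) (embed z)
        z∈L with embed-InLayer z
        ... | inj₁ z∈L = z∈L
        ... | inj₂ (at _ side≡) = ⊥-elim (not-¬ refl (trans (sym side-z) (trans (cong side (sym (vertex-combine z _))) side≡)))
        lifted = lift-backward z∈L
          (subst (λ x → G x y ≡ true) (sym (vertex-combine z _)) (trans (sym-G z y) (proj₂ (no-isolated y))))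

    Meets : ℕ → Fin (v * n) → Set
    Meets B r = Touches r B ⊎ Touches r (suc B)

    preimage : ℕ → Subset v
    preimage B = tabulate (lookup S ∘ Block.embed B)

    inBlock : ℕ → Fin (v * n) → Bool
    inBlock B q = layer B q ∨ layer (suc B) q

    ∣S∩Block∣ : ℕ → ℕ
    ∣S∩Block∣ B = count (λ q → lookup S q ∧ inBlock B q)

    ∣preimage∣≤∣S∩Block∣ : ∀ B → ∣ preimage B ∣ ≤ ∣S∩Block∣ B
    ∣preimage∣≤∣S∩Block∣ B = begin
      ∣ preimage B ∣                                     ≡⟨ ∣tabulate∣≡count (lookup S ∘ embed) ⟩
      count (lookup S ∘ embed)
        ≤⟨ count-mono {q = λ x → lookup S (embed x) ∧ inBlock B (embed x)} (λ x x∈S → ∧-true x∈S (in-block x)) ⟩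
      count (λ x → lookup S (embed x) ∧ inBlock B (embed x))
        ≤⟨ count-section {v} {n} (λ q → lookup S q ∧ inBlock B q) (slotOf ∘ side) ⟩
      ∣S∩Block∣ B                                        ∎
      where
      open ≤-Reasoning
      open Block B
      in-block : ∀ x → inBlock B (embed x) ≡ true
      in-block x with embed-InLayer x
      ... | inj₁ x∈L rewrite dec-true (inLayer? B (embed x)) x∈L = refl
      ... | inj₂ x∈L rewrite dec-true (inLayer? (suc B) (embed x)) x∈L = ∨-zeroʳ _

    Meets⇒reaches-embedded : ∀ {r} B → Meets B r → ∃ λ x → Reach H S r (Block.embed B x)
    Meets⇒reaches-embedded B (inj₁ (q , q∈L , walk)) =
      vertex q , subst (Reach H S _) (sym (Block.embed-vertex B q (inj₁ q∈L))) walk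
    Meets⇒reaches-embedded B (inj₂ (q , q∈L , walk)) =
      vertex q , subst (Reach H S _) (sym (Block.embed-vertex B q (inj₂ q∈L))) walk

    preimage-cut : ∀ {u w} B → ¬ Reach H S u w → Meets B u → Meets B w → IsCut G (preimage B)
    preimage-cut {u} {w} B ¬walk meets-u meets-w with Meets⇒reaches-embedded B meets-u | Meets⇒reaches-embedded B meets-w
    ... | x , walk-x | y , walk-y = x , y , reached∉ walk-x , reached∉ walk-y ,
      λ walk → ¬walk (Reach-trans walk-x (Reach-trans (Reach-map embed embed-edge avoid walk) (Reach-sym H-sym walk-y)))
      where
      open Block B
      reached∉ : ∀ {r x} → Reach H S r (embed x) → x ∉ preimage B
      reached∉ {x = x} walk =
        lookup-false⇒∉ (trans (lookup∘tabulate (lookup S ∘ embed) x) (∉⇒lookup-false (Reach-target∉ walk)))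
      avoid : ∀ x → x ∉ preimage B → embed x ∉ S
      avoid x x∉ = lookup-false⇒∉ (trans (sym (lookup∘tabulate (lookup S ∘ embed) x)) (∉⇒lookup-false x∉))

    separate-sym : ∀ {T T'} → Separate T T' → Separate T' T
    separate-sym sep q q∈L′ q∈L = sep q q∈L q∈L′

    separate⇒disjoint : ∀ {T T'} → Separate T T' → Disjointᵇ (S∩L T) (S∩L T')
    separate⇒disjoint {T} {T'} sep q q∈S∩L q∈S∩L′ =
      sep q (does-true⇒ (inLayer? T q) (∧-true⇒ʳ (lookup S q) q∈S∩L))
            (does-true⇒ (inLayer? T' q) (∧-true⇒ʳ (lookup S q) q∈S∩L′))

    S∩L⊆S : ∀ T → S∩L T ⊆ᵇ lookup S
    S∩L⊆S T q q∈S∩L = ∧-true⇒ˡ _ q∈S∩L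

    ∣S∩L∣-pair : ∀ {a b} → Separate a b → ∣S∩L∣ a + ∣S∩L∣ b ≤ ∣ S ∣
    ∣S∩L∣-pair {a} {b} sep =
      ≤-trans (count-+-≤ (separate⇒disjoint sep) (S∩L⊆S a) (S∩L⊆S b)) (≤-reflexive (sym (∣S∣≡count S)))

    ∣S∩L∣-triple : ∀ {a b c} → Separate a b → Separate a c → Separate b c →
                   ∣S∩L∣ a + ∣S∩L∣ b + ∣S∩L∣ c ≤ ∣ S ∣
    ∣S∩L∣-triple {a} {b} {c} sep-ab sep-ac sep-bc = begin
      ∣S∩L∣ a + ∣S∩L∣ b + ∣S∩L∣ c
        ≡⟨ cong (_+ ∣S∩L∣ c) (count-∨ (S∩L a) (S∩L b) (separate⇒disjoint sep-ab)) ⟩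
      count (λ q → S∩L a q ∨ S∩L b q) + ∣S∩L∣ c          ≤⟨ count-+-≤ disjoint ab⊆S (S∩L⊆S c) ⟩
      count (lookup S)                                   ≡⟨ ∣S∣≡count S ⟨
      ∣ S ∣                                              ∎
      where
      open ≤-Reasoning
      disjoint : Disjointᵇ (λ q → S∩L a q ∨ S∩L b q) (S∩L c)
      disjoint q q∈ab q∈c with S∩L a q in q∈a
      ... | true = separate⇒disjoint sep-ac q q∈a q∈c
      ... | false = separate⇒disjoint sep-bc q q∈ab q∈c
      ab⊆S : (λ q → S∩L a q ∨ S∩L b q) ⊆ᵇ lookup S
      ab⊆S q q∈ab with S∩L a q in q∈a
      ... | true = S∩L⊆S a q q∈a
      ... | false = S∩L⊆S b q q∈ab

    inBlock⇒InLayer : ∀ {B q} → inBlock B q ≡ true → ∃ λ T → B ≤ T × T ≤ suc B × InLayer T q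
    inBlock⇒InLayer {B} {q} q∈block with layer B q in q∈L
    ... | true = B , ≤-refl , n≤1+n B , does-true⇒ (inLayer? B q) q∈L
    ... | false = suc B , n≤1+n B , ≤-refl , does-true⇒ (inLayer? (suc B) q) q∈block

    blocks-disjoint : ∀ q (k k' : Fin n) → inBlock (2 * toℕ k) q ≡ true → inBlock (2 * toℕ k') q ≡ true → k ≡ k'
    blocks-disjoint q k k' q∈k q∈k' with inBlock⇒InLayer q∈k | inBlock⇒InLayer q∈k' | <-cmp (toℕ k) (toℕ k')
    ... | T , _ , T≤ , q∈T | T' , ≤T' , T'≤ , q∈T' | tri< k<k' _ _ =
      ⊥-elim (InLayer-window (pair-blocks-ordered k<k' T≤ ≤T') (pair-block-within n (Finₚ.toℕ<n k') T'≤) q∈T q∈T')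
    ... | _ , _ , _ , _ | _ , _ , _ , _ | tri≈ _ k≡k' _ = Finₚ.toℕ-injective k≡k'
    ... | T , ≤T , T≤ , q∈T | T' , _ , T'≤ , q∈T' | tri> _ _ k'<k =
      ⊥-elim (InLayer-window (pair-blocks-ordered k'<k T'≤ ≤T) (pair-block-within n (Finₚ.toℕ<n k) T≤) q∈T' q∈T)

    blocks-sum : ∑[ k < n ] ∣S∩Block∣ (2 * toℕ k) ≤ ∣ S ∣
    blocks-sum = ≤-trans
      (sum-count-disjoint (λ k q → lookup S q ∧ inBlock (2 * toℕ k) q) (lookup S) (λ k q q∈ → ∧-true⇒ˡ _ q∈)
        (λ q k k' q∈k q∈k' → blocks-disjoint q k k' (∧-true⇒ʳ (lookup S q) q∈k) (∧-true⇒ʳ (lookup S q) q∈k')))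
      (≤-reflexive (sym (∣S∣≡count S)))

    all-blocks-met⇒nκ≤∣S∣ : ∀ {u w κ} → (∀ T → IsCut G T → κ ≤ ∣ T ∣) → ¬ Reach H S u w →
      (∀ (k : Fin n) → Meets (2 * toℕ k) u × Meets (2 * toℕ k) w) → n * κ ≤ ∣ S ∣
    all-blocks-met⇒nκ≤∣S∣ {κ = κ} κ-lower ¬walk met = begin
      n * κ                            ≡⟨ sum-const n κ ⟨
      ∑[ k < n ] κ                     ≤⟨ sum-mono-≤ block-bound ⟩
      ∑[ k < n ] ∣S∩Block∣ (2 * toℕ k) ≤⟨ blocks-sum ⟩
      ∣ S ∣                            ∎
      where
      open ≤-Reasoning
      block-bound : ∀ k → κ ≤ ∣S∩Block∣ (2 * toℕ k)
      block-bound k =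
        ≤-trans (κ-lower _ (preimage-cut _ ¬walk (proj₁ (met k)) (proj₂ (met k)))) (∣preimage∣≤∣S∩Block∣ _)

    module _ (conn : Connected G) (no-isolated : ∀ x → ∃ λ y → G x y ≡ true)
             (sides-large : ∀ b → suc (δ G) ≤ count (sideClass side b))
             (∣S∣≤2δ : ∣ S ∣ ≤ 2 * δ G) (unsaturated : ∀ z → ¬ Saturated z) where

      crossings⇒⊥ : ∀ {r a b} → (∀ T → Dec (Touches r T)) → a < suc b → suc b < a + 2 * n →
                    ¬ Touches r a → Touches r (suc a) → Touches r b → ¬ Touches r (suc b) → ⊥
      crossings⇒⊥ {r} {a} {b} touches? a<b+1 b+1<a+2n ¬Ta Ta+1 Tb ¬Tb+1 with touches? (suc (suc a))
      ... | no ¬Ta+2 = unsaturated _ (proj₂ (saturated-between-untouched ¬Ta Ta+1 ¬Ta+2))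
      ... | yes Ta+2 = squeeze-pair large-a δ≤b (≤-trans (∣S∩L∣-pair sep-ab) ∣S∣≤2δ)
        where
        δ≤a = δ≤∣S∩L∣-behind ¬Ta Ta+1
        δ≤b = δ≤∣S∩L∣-ahead Tb ¬Tb+1
        sep-ab : Separate a (suc b)
        sep-ab q = InLayer-window a<b+1 b+1<a+2n
        -- Layers a and b+1 already hold δ vertices of S each, so any touched layer holds none.
        empty : ∀ {T} → Touches r T → ∣S∩L∣ T ≡ 0
        empty T = squeeze-third δ≤a δ≤b (≤-trans (∣S∩L∣-triple sep-ab
          (separate-sym (touched-untouched-separate T ¬Ta)) (separate-sym (touched-untouched-separate T ¬Tb+1))) ∣S∣≤2δ)
        large-a : suc (δ G) ≤ ∣S∩L∣ a
        large-a = ≤-trans (sides-large (isOdd a)) (side-class≤∣S∩L∣ conn no-isolated ¬Ta Ta+1 (empty Ta+1) (empty Ta+2))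

      missed-block⇒⊥ : ∀ {r} k → k < n → r ∉ S → (∀ T → Dec (Touches r T)) → ¬ Meets (2 * k) r → ⊥
      missed-block⇒⊥ {r} k k<n r∉S touches? ¬meets
        with representative (side (vertex r)) (Finₚ.toℕ<n (index r))
      ... | T₀ , T₀<2n , T₀≡ , parity
        with periodic-crossings (Touches r) touches? (2 * n) Touches-+2n Touches-∸2n
               (≤-trans (≤-reflexive (sym (*-suc 2 k))) (*-monoʳ-≤ 2 k<n)) T₀<2n
               (r , at (sym T₀≡) (sym parity) , here r∉S) (¬meets ∘ inj₁) (¬meets ∘ inj₂)
      ... | a , b , a<b+1 , b+1<a+2n , ¬Ta , Ta+1 , Tb , ¬Tb+1 = crossings⇒⊥ touches? a<b+1 b+1<a+2n ¬Ta Ta+1 Tb ¬Tb+1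

      cut⇒⊥ : ∀ {κ} → (∀ T → IsCut G T → κ ≤ ∣ T ∣) → 2 * δ G < n * κ → IsCut H S → ⊥
      cut⇒⊥ κ-lower 2δ<nκ (u , w , u∉S , w∉S , ¬walk) =
        ¬¬-Touches-decidable u λ u? → ¬¬-Touches-decidable w λ w? → decide u? w?
        where
        meets? : ∀ {r} → (∀ T → Dec (Touches r T)) → ∀ B → Dec (Meets B r)
        meets? touches? B = touches? B ⊎-dec touches? (suc B)
        decide : (∀ T → Dec (Touches u T)) → (∀ T → Dec (Touches w T)) → ⊥
        decide u? w? with all? (λ k → meets? u? (2 * toℕ k) ×-dec meets? w? (2 * toℕ k))
        ... | yes all-met = <⇒≱ 2δ<nκ (≤-trans (all-blocks-met⇒nκ≤∣S∣ κ-lower ¬walk all-met) ∣S∣≤2δ)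
        ... | no ¬all with ¬∀⟶∃¬ n _ (λ k → meets? u? (2 * toℕ k) ×-dec meets? w? (2 * toℕ k)) ¬all
        ...   | k , ¬both with meets? u? (2 * toℕ k) | meets? w? (2 * toℕ k)
        ...     | no ¬meets-u | _ = missed-block⇒⊥ (toℕ k) (Finₚ.toℕ<n k) u∉S u? ¬meets-u
        ...     | yes _ | no ¬meets-w = missed-block⇒⊥ (toℕ k) (Finₚ.toℕ<n k) w∉S w? ¬meets-w
        ...     | yes meets-u | yes meets-w = ¬both (meets-u , meets-w)

  H-loopless : (∀ x → G x x ≡ false) → ∀ q → H q q ≡ false
  H-loopless loopless q = cong (_∧ _) (loopless (vertex q))

  H-non-universal : (∀ x → G x x ≡ false) → 1 ≤ t → ∀ q → ∃ λ q' → q ≢ q' × H q q' ≡ false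
  H-non-universal loopless 1≤t q with Fin-other (s≤s (≤-trans 1≤t (m≤n*m t 2))) (index q)
  ... | j , index≢j = combine (vertex q) j , (λ q≡ → index≢j (trans (cong index q≡) (index-combine (vertex q) j))) ,
                      trans (H-at q (vertex q) j) (cong (_∧ _) (loopless (vertex q)))

  δH≤2δ : 0 < v → δ H ≤ 2 * δ G
  δH≤2δ 0<v with δ-attained G 0<v
  ... | x , deg≡δ = begin
    δ H                                  ≤⟨ δ≤deg H (combine x zero) ⟩
    deg H (combine x zero)               ≡⟨ deg-×ᵍ G (Cycle n) x zero ⟩
    deg G x * deg (Cycle n) zero         ≤⟨ *-monoʳ-≤ (deg G x) (Cycle-deg≤2 {2 * t} zero) ⟩
    deg G x * 2                          ≡⟨ cong (_* 2) deg≡δ ⟩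
    δ G * 2                              ≡⟨ *-comm (δ G) 2 ⟩
    2 * δ G                              ∎
    where open ≤-Reasoning

  H-min-cut≤δ : (∀ x → G x x ≡ false) → 0 < v → 1 ≤ t → ∀ {S} → IsMinCut H S → ∣ S ∣ ≤ δ H
  H-min-cut≤δ loopless 0<v 1≤t = min-cut≤δ H (H-loopless loopless) (H-non-universal loopless 1≤t) (≤-trans 0<v (m≤m*n v n))

  H-superConnected : (∀ x → G x x ≡ false) → Connected G → (∀ x → ∃ λ y → G x y ≡ true) →
    (∀ b → suc (δ G) ≤ count (sideClass side b)) → 0 < v → 1 ≤ t →
    ∀ {κ} → (∀ T → IsCut G T → κ ≤ ∣ T ∣) → 2 * δ G < n * κ → SuperConnected H
  H-superConnected loopless conn no-isolated sides-large 0<v 1≤t κ-lower 2δ<nκ S S-min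
    with any? (λ z → all? (λ q → (H z q ≟ᵇ true) →-dec (lookup S q ≟ᵇ true)))
  ... | yes (z , saturated) = z , saturated⇒≡N H S z (H-min-cut≤δ loopless 0<v 1≤t S-min) saturated
  ... | no unsaturated = ⊥-elim (Cut.cut⇒⊥ S conn no-isolated sides-large
          (≤-trans (H-min-cut≤δ loopless 0<v 1≤t S-min) (δH≤2δ 0<v))
          (λ z saturated → unsaturated (z , saturated)) κ-lower 2δ<nκ (proj₁ S-min))

theorem3p5 : ∀ {v : ℕ} (G : Graph v) (side : Fin v → Bool) (n : ℕ) (κ : ℕ)
    → IsSimple G → Connected G → IsBipartition G side
    → 3 ≤ n → Σ ℕ (λ t → n ≡ suc (2 * t))
    → suc (δ G) ≤ ∣ X side ∣ → suc (δ G) ≤ ∣ Y side ∣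
    → IsConnectivity G κ → 2 * δ G < n * κ
    → SuperConnected (G ×ᵍ Cycle n)
theorem3p5 {v} G side .(suc (2 * t)) κ (sym-G , loopless) conn bip 3≤n (t , refl) δ<∣X∣ δ<∣Y∣ κ-is 2δ<nκ =
  OddCycleProduct.H-superConnected G side t sym-G bip loopless conn no-isolated sides-large 0<v (*-cancelˡ-≤ 2 (s≤s⁻¹ 3≤n))
    (connectivity≤cut κ-is incomplete) 2δ<nκ
  where
  sides-large : ∀ b → suc (δ G) ≤ count (sideClass side b)
  sides-large false = subst (suc (δ G) ≤_) (∣X∣≡count-class side) δ<∣X∣
  sides-large true = subst (suc (δ G) ≤_) (∣Y∣≡count-class side) δ<∣Y∣
  no-isolated = connected-bipartite-no-isolated {side = side} conn (λ b → ≤-trans (s≤s z≤n) (sides-large b))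
  0<v : 0 < v
  0<v with count-witness (sideClass side true) (≤-trans (s≤s z≤n) (sides-large true))
  ... | x , _ = ≤-<-trans z≤n (Finₚ.toℕ<n x)
  incomplete : ¬ IsComplete G
  incomplete complete = 1+n≰n (≤-trans (s≤s (δ≥1 G 0<v no-isolated))
                                       (≤-trans (sides-large false) (complete-bipartite-class≤1 complete bip false)))
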